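{- A sorted configuration $c$ on $K_{m,n}$ is a $K_{m,n}$-parking configuration if and only if there exist $(u'',\ell')\in B_{m-1,n-1}\times B_{m-1,n}$ and a stable intersection $y=(y_1,y_2)$ of $((Nu'')^{\mathbb{Z}},(E\ell')^{\mathbb{Z}})$ such that $c=M(u'',\ell',y)$ and $\mathrm{pos}(\mathcal{E}_{y_1+i})\le0$ for all $i=1,\dots,m-1$.
   Context: $m,n$ positive integers. $K_{m,n}$: vertices $v_1,\dots,v_{n+m}$, single edge $v_iv_j$ iff $i\le n<j$, sink $v_{n+m}$; configurations $c\in\mathbb{Z}^{n+m-1}$. Toppling vectors $\Delta_i$: for $i\le n$ entry $m$ at $i$, $-1$ at $n+1,\dots,n+m-1$; for $n<i<n+m$ entry $n$ at $i$, $-1$ at $1,\dots,n$; $\Delta_A=\sum_{i\in A}\Delta_i$. $c$ is non-negative if all $c_i\ge0$, stable if moreover $c_i\le m-1$ ($i\le n$) and $c_i\le n-1$ ($n<i<n+m$); a stable $c$ is $K_{m,n}$-parking if $c-\Delta_A$ is not non-negative for every nonempty $A\subseteq\{1,\dots,n+m-1\}$. Sorted: $c_1\le\dots\le c_n$ and $c_{n+1}\le\dots\le c_{n+m-1}$. $B_{p,q}$: words over $\{N,E\}$ with $p$ letters $E$ and $q$ letters $N$, read as lattice paths ($N=(0,1)$, $E=(1,0)$); $w^{\mathbb{Z}}$ is the concatenation over $i\in\mathbb{Z}$ of the paths from $(pi,qi)$ with steps $w$. $R=(Nu'')^{\mathbb{Z}}$, $G=(E\ell')^{\mathbb{Z}}$.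 A stable intersection is a lattice point on both paths where $R$ continues with $N$ and $G$ with $E$. $N_i$: unique north step of $G$ starting at ordinate $i$, $X_1(N_i)$ its starting abscissa; $E_j$: unique east step of $R$ starting at abscissa $j$, $X_2(E_j)$ its starting ordinate; $M(u'',\ell',y)=(c_1,\dots,c_{n+m-1})$ with $c_{i+1}=X_1(N_{y_2+i})-y_1-1$ ($0\le i\le n-1$) and $c_{n+1+j}=X_2(E_{y_1+j})-y_2-1$ ($0\le j\le m-2$). Further, $\mathcal{E}_k$ denotes the unique east step of $G$ whose starting point has abscissa $k$; if its starting point is $(k,h)$, then $\mathrm{pos}(\mathcal{E}_k)=k-a$ where $a$ is the abscissa of the starting point of the unique north step of $R$ starting at ordinate $h$. -}

module Defs where

open import Data.Nat as ℕ using (ℕ; zero; suc; _∸_)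
open import Data.Integer as ℤ using (ℤ; +_; _-_; _+_; _*_; _≤_; -1ℤ; 0ℤ; 1ℤ)
open import Data.Fin as Fin using (Fin; toℕ; splitAt; _↑ˡ_; _↑ʳ_)
open import Data.Fin.Subset using (Subset; Nonempty)
open import Data.List using (List; []; _∷_; length; lookup; take)
open import Data.Vec as Vec using ()
open import Data.Bool using (if_then_else_)
open import Data.Sum using (inj₁; inj₂)
open import Data.Product using (Σ; _×_; ∃; ∃-syntax)
open import Relation.Nullary using (¬_; does)
open import Relation.Binary.PropositionalEquality using (_≡_)

-- Configurations on K_{m,n}
-- Index set {1,…,n+m-1} is Fin (n + (m ∸ 1)); the vertex v_{i+1}
-- (0 ≤ i < n) is  i ↑ˡ (m ∸ 1)  and v_{n+1+j} (0 ≤ j ≤ m-2) is  n ↑ʳ j.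

Config : ℕ → ℕ → Set
Config n m = Fin (n ℕ.+ (m ∸ 1)) → ℤ

left : ∀ {n m} → Config n m → Fin n → ℤ
left {n} {m} c i = c (i ↑ˡ (m ∸ 1))

right : ∀ {n m} → Config n m → Fin (m ∸ 1) → ℤ
right {n} c j = c (n ↑ʳ j)

Δ : (n m : ℕ) → Fin (n ℕ.+ (m ∸ 1)) → Config n m
Δ n m i k with splitAt n i | splitAt n k
... | inj₁ i' | inj₁ k' = if does (i' Fin.≟ k') then + m else 0ℤ
... | inj₁ _  | inj₂ _  = -1ℤ
... | inj₂ _  | inj₁ _  = -1ℤ
... | inj₂ i' | inj₂ k' = if does (i' Fin.≟ k') then + n else 0ℤ

∑ : ∀ {K} → (Fin K → ℤ) → ℤ
∑ {zero}  f = 0ℤ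
∑ {suc K} f = f Fin.zero + ∑ (λ i → f (Fin.suc i))

ΔSet : (n m : ℕ) → Subset (n ℕ.+ (m ∸ 1)) → Config n m
ΔSet n m A k = ∑ (λ i → if Vec.lookup A i then Δ n m i k else 0ℤ)

NonNegative : (n m : ℕ) → Config n m → Set
NonNegative n m c = ∀ k → 0ℤ ≤ c k

Stable : (n m : ℕ) → Config n m → Set
Stable n m c = NonNegative n m c
             × (∀ i → left {n} {m} c i ≤ + (m ∸ 1))
             × (∀ j → right {n} {m} c j ≤ + (n ∸ 1))

Parking : (n m : ℕ) → Config n m → Set
Parking n m c = Stable n m c
              × (∀ (A : Subset (n ℕ.+ (m ∸ 1))) → Nonempty A →
                   ¬ NonNegative n m (λ k → c k - ΔSet n m A k))

Sorted : (n m : ℕ) → Config n m → Set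
Sorted n m c = (∀ (i j : Fin n) → i Fin.≤ j → left {n} {m} c i ≤ left {n} {m} c j)
             × (∀ (i j : Fin (m ∸ 1)) → i Fin.≤ j → right {n} {m} c i ≤ right {n} {m} c j)

data Step : Set where
  N E : Step

Word : Set
Word = List Step

countN : Word → ℕ
countN []      = 0
countN (N ∷ w) = suc (countN w)
countN (E ∷ w) = countN w

countE : Word → ℕ
countE []      = 0
countE (E ∷ w) = suc (countE w)
countE (N ∷ w) = countE w

B : ℕ → ℕ → Word → Set
B p q w = countE w ≡ p × countN w ≡ q

-- StartsStep w a x y : in the bi-infinite path w^ℤ (concatenation over
-- i ∈ ℤ of the paths from (p i, q i) with steps w, where p = #E, q = #N),
-- some step starts at the lattice point (x , y) and that step is a.
-- (The r-th letter of the i-th copy starts at (p i, q i) + prefix counts.)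
StartsStep : Word → Step → ℤ → ℤ → Set
StartsStep w a x y =
  Σ ℤ λ i → Σ (Fin (length w)) λ r →
      lookup w r ≡ a
    × x ≡ + countE w * i + + countE (take (toℕ r) w)
    × y ≡ + countN w * i + + countN (take (toℕ r) w)

Rw : Word → Word
Rw u'' = N ∷ u''

Gw : Word → Word
Gw ℓ' = E ∷ ℓ'

StableIntersection : Word → Word → ℤ → ℤ → Set
StableIntersection u'' ℓ' y₁ y₂ =
  StartsStep (Rw u'') N y₁ y₂ × StartsStep (Gw ℓ') E y₁ y₂

-- X₁(N_h) = x : the (unique) north step of G starting at ordinate h
-- starts at abscissa x.
X₁-is : Word → ℤ → ℤ → Set
X₁-is ℓ' h x = StartsStep (Gw ℓ') N x h

-- X₂(E_k) = y : the (unique) east step of R starting at abscissa k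
-- starts at ordinate y.
X₂-is : Word → ℤ → ℤ → Set
X₂-is u'' k y = StartsStep (Rw u'') E k y

IsM : (n m : ℕ) → Word → Word → ℤ → ℤ → Config n m → Set
IsM n m u'' ℓ' y₁ y₂ c =
    (∀ (i : Fin n) → X₁-is ℓ' (y₂ + + toℕ i) (left {n} {m} c i + y₁ + 1ℤ))
  × (∀ (j : Fin (m ∸ 1)) → X₂-is u'' (y₁ + + toℕ j) (right {n} {m} c j + y₂ + 1ℤ))

-- pos(𝓔_k) = v : the east step 𝓔_k of G starting at abscissa k starts at
-- (k , h), the north step of R at ordinate h starts at abscissa a, and v = k - a.
Pos-is : Word → Word → ℤ → ℤ → Set
Pos-is u'' ℓ' k v =
  ∃[ h ] ∃[ a ] (StartsStep (Gw ℓ') E k h × StartsStep (Rw u'') N a h × v ≡ k - a)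

-- For a stable c with left values aᵢ and right values bⱼ, firing a set of
-- vertices containing s right and t left vertices is legal iff every fired
-- left vertex has aᵢ + s ≥ m and every fired right vertex has bⱼ + t ≥ n.
-- Taking k = m − s shows that c is parking iff for every 1 ≤ k ≤ m − 1 at
-- least k right values lie below #{i | aᵢ < k} (the cut condition).
-- On the path side, a north step and an east step of a periodic path never
-- cross. For c = M(u'', ℓ', y) the north step of G at height y₂ + i starts at
-- abscissa y₁ + aᵢ + 1 and the east step of R at abscissa y₁ + j at height
-- y₂ + bⱼ + 1; comparing these with the periods of G and R and with the
-- stable intersection gives stability, and pos(𝓔_{y₁+k}) ≤ 0 yields the cut
-- condition at k. Conversely, for sorted c the staircase words spelled by the
-- sorted values realise c with y = (0, 0), and the cut condition forces
-- pos(𝓔_k) ≤ 0.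

module Submission where

open import Defs
open import Data.Nat using (ℕ; zero; suc; z≤n; s≤s; _∸_; _<ᵇ_)
import Data.Nat as ℕ
import Data.Nat.Properties as ℕP
open import Data.Integer using (ℤ; +_; _+_; _-_; -_; _*_; _≤_; _<_; 0ℤ; 1ℤ; -1ℤ; +≤+; +<+; ∣_∣)
import Data.Integer.Properties as ℤP
open import Data.Integer.DivMod using (_/ℕ_; _%ℕ_; a≡a%ℕn+[a/ℕn]*n; n%ℕd<d)
open import Data.Integer.Tactic.RingSolver using (solve-∀)
open import Data.Fin using (Fin; toℕ; _↑ˡ_; _↑ʳ_; splitAt)
import Data.Fin as Fin
import Data.Fin.Properties as FinP
open import Data.Fin.Subset using (Subset; Nonempty)
open import Data.Bool using (Bool; true; false; not; T; if_then_else_)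
open import Data.Bool.Properties using (T-≡; T-not-≡)
open import Data.Unit using (tt)
open import Data.Empty using (⊥; ⊥-elim)
open import Data.List using ([]; _∷_; _++_; length; lookup; take; replicate)
import Data.List.Properties as ListP
import Data.Vec as Vec
import Data.Vec.Properties as VecP
open import Data.Product using (Σ; _,_; proj₁; proj₂; _×_; ∃-syntax)
open import Data.Sum using (_⊎_; inj₁; inj₂)
open import Function.Base using (case_of_; _∘_)
open import Function.Bundles using (_⇔_; mk⇔; Equivalence)
open import Relation.Nullary using (¬_; does; yes; no)
open import Relation.Binary.Definitions using (tri<; tri≈; tri>)
open import Relation.Binary.PropositionalEquality

match : Step → Step → ℕ
match N N = 1
match N E = 0
match E N = 0
match E E = 1

other : Step → Step
other N = E
other E = N

count : Step → Word → ℕ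
count a []      = 0
count a (b ∷ w) = match a b ℕ.+ count a w

countN≡count : ∀ w → countN w ≡ count N w
countN≡count []      = refl
countN≡count (N ∷ w) = cong suc (countN≡count w)
countN≡count (E ∷ w) = countN≡count w

countE≡count : ∀ w → countE w ≡ count E w
countE≡count []      = refl
countE≡count (E ∷ w) = cong suc (countE≡count w)
countE≡count (N ∷ w) = countE≡count w

count-take-suc : ∀ a w (r : Fin (length w)) →
  count a (take (suc (toℕ r)) w) ≡ count a (take (toℕ r) w) ℕ.+ match a (lookup w r)
count-take-suc a (b ∷ w) Fin.zero    = ℕP.+-identityʳ (match a b)
count-take-suc a (b ∷ w) (Fin.suc r) =
  trans (cong (match a b ℕ.+_) (count-take-suc a w r)) (sym (ℕP.+-assoc (match a b) _ _))

count-take-mono : ∀ a w {r r'} → r ℕ.≤ r' → count a (take r w) ℕ.≤ count a (take r' w)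
count-take-mono a w       {zero}          _         = z≤n
count-take-mono a []      {suc r} {suc r'} _        = z≤n
count-take-mono a (b ∷ w) {suc r} {suc r'} (s≤s r≤r') =
  ℕP.+-monoʳ-≤ (match a b) (count-take-mono a w r≤r')

count-take-≤ : ∀ a w r → count a (take r w) ℕ.≤ count a w
count-take-≤ a w       zero    = z≤n
count-take-≤ a []      (suc r) = z≤n
count-take-≤ a (b ∷ w) (suc r) = ℕP.+-monoʳ-≤ (match a b) (count-take-≤ a w r)

count-++ : ∀ a u w → count a (u ++ w) ≡ count a u ℕ.+ count a w
count-++ a []      w = refl
count-++ a (b ∷ u) w = trans (cong (match a b ℕ.+_) (count-++ a u w)) (sym (ℕP.+-assoc (match a b) _ _))

match-self : ∀ a → match a a ≡ 1
match-self N = refl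
match-self E = refl

match-other : ∀ a → match a (other a) ≡ 0
match-other N = refl
match-other E = refl

match-other-self : ∀ a → match (other a) a ≡ 0
match-other-self N = refl
match-other-self E = refl

count-replicate-self : ∀ a k → count a (replicate k a) ≡ k
count-replicate-self a zero    = refl
count-replicate-self a (suc k) rewrite match-self a = cong suc (count-replicate-self a k)

count-other-replicate : ∀ a k → count (other a) (replicate k a) ≡ 0
count-other-replicate a zero    = refl
count-other-replicate a (suc k) rewrite match-other-self a = count-other-replicate a k

coord : Step → (w : Word) → ℤ → Fin (length w) → ℤ
coord a w i r = + count a w * i + + count a (take (toℕ r) w)

-- StartsStep with countE and countN read as count E and count N, so that an
-- argument about one axis serves for both.
StepAt : Word → Step → ℤ → ℤ → Set
StepAt w a x y = Σ ℤ λ i → Σ (Fin (length w)) λ r →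
  lookup w r ≡ a × x ≡ coord E w i r × y ≡ coord N w i r

startsStep⇒stepAt : ∀ {w a x y} → StartsStep w a x y → StepAt w a x y
startsStep⇒stepAt {w} (i , r , w[r]≡a , x≡ , y≡) = i , r , w[r]≡a ,
  trans x≡ (cong₂ (λ p q → + p * i + + q) (countE≡count w) (countE≡count (take (toℕ r) w))) ,
  trans y≡ (cong₂ (λ p q → + p * i + + q) (countN≡count w) (countN≡count (take (toℕ r) w)))

stepAt⇒startsStep : ∀ {w a x y} → StepAt w a x y → StartsStep w a x y
stepAt⇒startsStep {w} (i , r , w[r]≡a , x≡ , y≡) = i , r , w[r]≡a ,
  trans x≡ (sym (cong₂ (λ p q → + p * i + + q) (countE≡count w) (countE≡count (take (toℕ r) w)))) ,
  trans y≡ (sym (cong₂ (λ p q → + p * i + + q) (countN≡count w) (countN≡count (take (toℕ r) w))))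

Before : ∀ {w : Word} → ℤ → Fin (length w) → ℤ → Fin (length w) → Set
Before i r i' r' = i < i' ⊎ (i ≡ i' × toℕ r ℕ.< toℕ r')

coord-after-≤ : ∀ a w {i i' r r'} → Before {w} i r i' r' →
  + match a (lookup w r) + coord a w i r ≤ coord a w i' r'
coord-after-≤ a w {i} {i'} {r} {r'} before = begin
  + match a (lookup w r) + (+ c * i + + C)   ≡⟨ rearrange (+ match a (lookup w r)) (+ c * i) (+ C) ⟩
  + c * i + (+ C + + match a (lookup w r))   ≡⟨ cong (λ z → + c * i + z) (sym (ℤP.pos-+ C _)) ⟩
  + c * i + + (C ℕ.+ match a (lookup w r))   ≡⟨ cong (λ z → + c * i + + z) (sym (count-take-suc a w r)) ⟩
  + c * i + + count a (take (suc (toℕ r)) w) ≤⟨ later before ⟩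
  coord a w i' r'                            ∎
  where
  open ℤP.≤-Reasoning
  c C : ℕ
  c = count a w
  C = count a (take (toℕ r) w)
  rearrange : ∀ p q s → p + (q + s) ≡ q + (s + p)
  rearrange = solve-∀
  copy-step : ∀ p j → p * j + p ≡ p * (1ℤ + j)
  copy-step = solve-∀
  later : Before {w} i r i' r' → + c * i + + count a (take (suc (toℕ r)) w) ≤ coord a w i' r'
  later (inj₁ i<i') = begin
    + c * i + + count a (take (suc (toℕ r)) w)
      ≤⟨ ℤP.+-monoʳ-≤ (+ c * i) (+≤+ (count-take-≤ a w (suc (toℕ r)))) ⟩
    + c * i + + c   ≡⟨ copy-step (+ c) i ⟩
    + c * (1ℤ + i)  ≤⟨ ℤP.*-monoˡ-≤-nonNeg (+ c) (ℤP.i<j⇒suc[i]≤j i<i') ⟩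
    + c * i'        ≤⟨ ℤP.i≤i+j _ (+ count a (take (toℕ r') w)) ⟩
    coord a w i' r' ∎
  later (inj₂ (refl , r<r')) = ℤP.+-monoʳ-≤ (+ c * i) (+≤+ (count-take-mono a w r<r'))

step-before : ∀ a w {i i' r r'} → lookup w r ≡ a → Before {w} i r i' r' →
  coord a w i r < coord a w i' r' × coord (other a) w i r ≤ coord (other a) w i' r'
step-before a w {i} {i'} {r} {r'} w[r]≡a before =
    ℤP.suc[i]≤j⇒i<j (subst (λ s → + s + coord a w i r ≤ coord a w i' r')
                       (trans (cong (match a) w[r]≡a) (match-self a)) (coord-after-≤ a w before))
  , subst (_≤ coord (other a) w i' r') (ℤP.+-identityˡ _)
      (subst (λ s → + s + coord (other a) w i r ≤ coord (other a) w i' r')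
         (trans (cong (match (other a)) w[r]≡a) (match-other-self a)) (coord-after-≤ (other a) w before))

north-east-separated : ∀ w {x y x' y'} → StepAt w N x y → StepAt w E x' y' →
  (y < y' × x ≤ x') ⊎ (x' < x × y' ≤ y)
north-east-separated w (i , r , w[r]≡N , refl , refl) (i' , r' , w[r']≡E , refl , refl)
  with ℤP.<-cmp i i'
... | tri< i<i' _ _ = inj₁ (step-before N w {r = r} {r'} w[r]≡N (inj₁ i<i'))
... | tri> _ _ i'<i = inj₂ (step-before E w {r = r'} {r} w[r']≡E (inj₁ i'<i))
... | tri≈ _ refl _ with ℕP.<-cmp (toℕ r) (toℕ r')
...   | tri< r<r' _ _ = inj₁ (step-before N w {r = r} {r'} w[r]≡N (inj₂ (refl , r<r')))
...   | tri> _ _ r'<r = inj₂ (step-before E w {r = r'} {r} w[r']≡E (inj₂ (refl , r'<r)))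
...   | tri≈ _ r≡r' _ with trans (sym w[r]≡N) (trans (cong (lookup w) (FinP.toℕ-injective r≡r')) w[r']≡E)
...     | ()

stepAt-+period : ∀ {w a x y} → StepAt w a x y → StepAt w a (x + + count E w) (y + + count N w)
stepAt-+period {w} (i , r , w[r]≡a , refl , refl) =
  i + 1ℤ , r , w[r]≡a , next-copy (+ count E w) i _ , next-copy (+ count N w) i _
  where
  next-copy : ∀ p j q → p * j + q + p ≡ p * (j + 1ℤ) + q
  next-copy = solve-∀

prefix-with-count : ∀ a w s → s ℕ.< count a w →
  Σ (Fin (length w)) λ r → lookup w r ≡ a × count a (take (toℕ r) w) ≡ s
prefix-with-count N (N ∷ w) zero    _         = Fin.zero , refl , refl
prefix-with-count E (E ∷ w) zero    _         = Fin.zero , refl , refl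
prefix-with-count N (N ∷ w) (suc s) (s≤s s<c) with prefix-with-count N w s s<c
... | r , w[r]≡N , c≡s = Fin.suc r , w[r]≡N , cong suc c≡s
prefix-with-count E (E ∷ w) (suc s) (s≤s s<c) with prefix-with-count E w s s<c
... | r , w[r]≡E , c≡s = Fin.suc r , w[r]≡E , cong suc c≡s
prefix-with-count N (E ∷ w) s       s<c       with prefix-with-count N w s s<c
... | r , w[r]≡N , c≡s = Fin.suc r , w[r]≡N , c≡s
prefix-with-count E (N ∷ w) s       s<c       with prefix-with-count E w s s<c
... | r , w[r]≡E , c≡s = Fin.suc r , w[r]≡E , c≡s

euclidean-division : ∀ d .{{_ : ℕ.NonZero d}} (z : ℤ) → Σ ℤ λ q → Σ ℕ λ s → s ℕ.< d × z ≡ + d * q + + s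
euclidean-division d z = z /ℕ d , z %ℕ d , n%ℕd<d z d ,
  trans (a≡a%ℕn+[a/ℕn]*n z d) (swap (+ (z %ℕ d)) (z /ℕ d) (+ d))
  where
  swap : ∀ s q p → s + q * p ≡ p * q + s
  swap = solve-∀

east-step-at : ∀ w x .{{_ : ℕ.NonZero (count E w)}} → Σ ℤ λ y → StepAt w E x y
east-step-at w x with euclidean-division (count E w) x
... | q , s , s<c , x≡ with prefix-with-count E w s s<c
... | r , w[r]≡E , c≡s = _ , q , r , w[r]≡E , trans x≡ (cong (λ t → + count E w * q + + t) (sym c≡s)) , refl

north-step-at : ∀ w y .{{_ : ℕ.NonZero (count N w)}} → Σ ℤ λ x → StepAt w N x y
north-step-at w y with euclidean-division (count N w) y
... | q , s , s<c , y≡ with prefix-with-count N w s s<c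
... | r , w[r]≡N , c≡s = _ , q , r , w[r]≡N , refl , trans y≡ (cong (λ t → + count N w * q + + t) (sym c≡s))

card : ∀ {K} → (Fin K → Bool) → ℕ
card {zero}  P = 0
card {suc K} P = (if P Fin.zero then 1 else 0) ℕ.+ card (λ i → P (Fin.suc i))

card-cong : ∀ {K} {P Q : Fin K → Bool} → (∀ i → P i ≡ Q i) → card P ≡ card Q
card-cong {zero}  P≗Q = refl
card-cong {suc K} P≗Q =
  cong₂ ℕ._+_ (cong (λ b → if b then 1 else 0) (P≗Q Fin.zero)) (card-cong (λ i → P≗Q (Fin.suc i)))

card-mono : ∀ {K} (P Q : Fin K → Bool) → (∀ i → T (P i) → T (Q i)) → card P ℕ.≤ card Q
card-mono {zero}  P Q P⊆Q = z≤n
card-mono {suc K} P Q P⊆Q with P Fin.zero in P₀ | Q Fin.zero in Q₀ | P⊆Q Fin.zero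
... | true  | true  | _ = s≤s (card-mono _ _ (λ i → P⊆Q (Fin.suc i)))
... | false | true  | _ = ℕP.m≤n⇒m≤1+n (card-mono _ _ (λ i → P⊆Q (Fin.suc i)))
... | false | false | _ = card-mono _ _ (λ i → P⊆Q (Fin.suc i))
... | true  | false | 0∈P⇒0∈Q = ⊥-elim (0∈P⇒0∈Q tt)

card≤ : ∀ {K} (P : Fin K → Bool) → card P ℕ.≤ K
card≤ {zero}  P = z≤n
card≤ {suc K} P with P Fin.zero
... | true  = s≤s (card≤ _)
... | false = ℕP.m≤n⇒m≤1+n (card≤ _)

card+card-not : ∀ {K} (P : Fin K → Bool) → card P ℕ.+ card (λ i → not (P i)) ≡ K
card+card-not {zero}  P = refl
card+card-not {suc K} P with P Fin.zero
... | true  = cong suc (card+card-not _)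
... | false = trans (ℕP.+-suc _ _) (cong suc (card+card-not _))

card<⇒∃∉ : ∀ {K} (P : Fin K → Bool) → card P ℕ.< K → Σ (Fin K) λ i → P i ≡ false
card<⇒∃∉ {suc K} P card<K with P Fin.zero in P₀
... | false = Fin.zero , P₀
... | true with card<⇒∃∉ (λ i → P (Fin.suc i)) (ℕP.≤-pred card<K)
...   | i , Pi≡false = Fin.suc i , Pi≡false

∈⇒0<card : ∀ {K} (P : Fin K → Bool) i → T (P i) → 0 ℕ.< card P
∈⇒0<card {suc K} P Fin.zero    i∈P with P Fin.zero
... | true = s≤s z≤n
∈⇒0<card {suc K} P (Fin.suc i) i∈P with P Fin.zero
... | true  = s≤s z≤n
... | false = ∈⇒0<card (λ j → P (Fin.suc j)) i i∈P

initial⊆⇒≤card : ∀ {K} (P : Fin K → Bool) t → t ℕ.≤ K → (∀ i → toℕ i ℕ.< t → T (P i)) →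
  t ℕ.≤ card P
initial⊆⇒≤card         P zero    _         _    = z≤n
initial⊆⇒≤card {suc K} P (suc t) (s≤s t≤K) init⊆P with P Fin.zero | init⊆P Fin.zero (s≤s z≤n)
... | true | _ = s≤s (initial⊆⇒≤card _ t t≤K (λ i i<t → init⊆P (Fin.suc i) (s≤s i<t)))

⊆initial⇒card≤ : ∀ {K} (P : Fin K → Bool) t → (∀ i → T (P i) → toℕ i ℕ.< t) → card P ℕ.≤ t
⊆initial⇒card≤ {zero}  P t       P⊆init = z≤n
⊆initial⇒card≤ {suc K} P zero    P⊆init with P Fin.zero | P⊆init Fin.zero
... | true  | 0<0 = ⊥-elim (ℕP.n≮0 (0<0 tt))
... | false | _   =
  ⊆initial⇒card≤ (λ i → P (Fin.suc i)) zero (λ i i∈P → ⊥-elim (ℕP.n≮0 (P⊆init (Fin.suc i) i∈P)))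
⊆initial⇒card≤ {suc K} P (suc t) P⊆init with P Fin.zero
... | true  =
  s≤s (⊆initial⇒card≤ (λ i → P (Fin.suc i)) t (λ i i∈P → ℕP.≤-pred (P⊆init (Fin.suc i) i∈P)))
... | false =
  ⊆initial⇒card≤ (λ i → P (Fin.suc i)) (suc t) (λ i i∈P → ℕP.<-trans (ℕP.n<1+n _) (P⊆init (Fin.suc i) i∈P))

∑-cong : ∀ {K} {f g : Fin K → ℤ} → (∀ i → f i ≡ g i) → ∑ f ≡ ∑ g
∑-cong {zero}  f≗g = refl
∑-cong {suc K} f≗g = cong₂ _+_ (f≗g Fin.zero) (∑-cong (λ i → f≗g (Fin.suc i)))

∑-splitAt : ∀ n K (f : Fin (n ℕ.+ K) → ℤ) → ∑ f ≡ ∑ (λ i → f (i ↑ˡ K)) + ∑ (λ j → f (n ↑ʳ j))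
∑-splitAt zero    K f = sym (ℤP.+-identityˡ _)
∑-splitAt (suc n) K f =
  trans (cong (λ z → f Fin.zero + z) (∑-splitAt n K (λ i → f (Fin.suc i)))) (sym (ℤP.+-assoc (f Fin.zero) _ _))

∑-zero : ∀ {K} (f : Fin K → ℤ) → (∀ i → f i ≡ 0ℤ) → ∑ f ≡ 0ℤ
∑-zero {zero}  f f≗0 = refl
∑-zero {suc K} f f≗0 = cong₂ _+_ (f≗0 Fin.zero) (∑-zero _ (λ i → f≗0 (Fin.suc i)))

if-0 : ∀ b → (if b then 0ℤ else 0ℤ) ≡ 0ℤ
if-0 true  = refl
if-0 false = refl

∑-if-−1 : ∀ {K} (P : Fin K → Bool) → ∑ (λ i → if P i then -1ℤ else 0ℤ) ≡ - + card P
∑-if-−1 {zero}  P = refl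
∑-if-−1 {suc K} P with P Fin.zero
... | true  = trans (cong (λ z → -1ℤ + z) (∑-if-−1 (λ i → P (Fin.suc i)))) (-1-neg (card (λ i → P (Fin.suc i))))
  where
  -1-neg : ∀ s → -1ℤ + - + s ≡ - + suc s
  -1-neg zero    = refl
  -1-neg (suc s) = refl
... | false = trans (ℤP.+-identityˡ _) (∑-if-−1 (λ i → P (Fin.suc i)))

∑-if-single : ∀ {K} (P : Fin K → Bool) (i₀ : Fin K) (v : ℤ) →
  ∑ (λ i → if P i then (if does (i Fin.≟ i₀) then v else 0ℤ) else 0ℤ) ≡ (if P i₀ then v else 0ℤ)
∑-if-single {suc K} P Fin.zero v =
  trans (cong (λ z → (if P Fin.zero then v else 0ℤ) + z) (∑-zero _ (λ i → if-0 (P (Fin.suc i)))))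
        (ℤP.+-identityʳ _)
∑-if-single {suc K} P (Fin.suc i₀) v =
  trans (cong (_+ ∑ (λ i → if P (Fin.suc i) then (if does (i Fin.≟ i₀) then v else 0ℤ) else 0ℤ)) (if-0 (P Fin.zero)))
        (trans (ℤP.+-identityˡ _) (∑-if-single (λ i → P (Fin.suc i)) i₀ v))

if-cong : ∀ (b : Bool) {x y : ℤ} → x ≡ y → (if b then x else 0ℤ) ≡ (if b then y else 0ℤ)
if-cong true  x≡y = x≡y
if-cong false x≡y = refl

module _ (n K : ℕ) where

  Δ-left-left : ∀ i i₀ → Δ n (suc K) (i ↑ˡ K) (i₀ ↑ˡ K) ≡ (if does (i Fin.≟ i₀) then + suc K else 0ℤ)
  Δ-left-left i i₀ rewrite FinP.splitAt-↑ˡ n i K | FinP.splitAt-↑ˡ n i₀ K = refl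

  Δ-right-left : ∀ j i₀ → Δ n (suc K) (n ↑ʳ j) (i₀ ↑ˡ K) ≡ -1ℤ
  Δ-right-left j i₀ rewrite FinP.splitAt-↑ʳ n K j | FinP.splitAt-↑ˡ n i₀ K = refl

  Δ-left-right : ∀ i j₀ → Δ n (suc K) (i ↑ˡ K) (n ↑ʳ j₀) ≡ -1ℤ
  Δ-left-right i j₀ rewrite FinP.splitAt-↑ˡ n i K | FinP.splitAt-↑ʳ n K j₀ = refl

  Δ-right-right : ∀ j j₀ → Δ n (suc K) (n ↑ʳ j) (n ↑ʳ j₀) ≡ (if does (j Fin.≟ j₀) then + n else 0ℤ)
  Δ-right-right j j₀ rewrite FinP.splitAt-↑ʳ n K j | FinP.splitAt-↑ʳ n K j₀ = refl

  leftPart : Subset (n ℕ.+ K) → Fin n → Bool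
  leftPart A i = Vec.lookup A (i ↑ˡ K)

  rightPart : Subset (n ℕ.+ K) → Fin K → Bool
  rightPart A j = Vec.lookup A (n ↑ʳ j)

  ΔSet-left : ∀ A i₀ →
    ΔSet n (suc K) A (i₀ ↑ˡ K) ≡ (if leftPart A i₀ then + suc K else 0ℤ) - + card (rightPart A)
  ΔSet-left A i₀ = trans (∑-splitAt n K _) (cong₂ _+_
    (trans (∑-cong (λ i → if-cong (leftPart A i) (Δ-left-left i i₀))) (∑-if-single (leftPart A) i₀ _))
    (trans (∑-cong (λ j → if-cong (rightPart A j) (Δ-right-left j i₀))) (∑-if-−1 (rightPart A))))

  ΔSet-right : ∀ A j₀ →
    ΔSet n (suc K) A (n ↑ʳ j₀) ≡ (if rightPart A j₀ then + n else 0ℤ) - + card (leftPart A)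
  ΔSet-right A j₀ = trans (∑-splitAt n K _) (trans (cong₂ _+_
    (trans (∑-cong (λ i → if-cong (leftPart A i) (Δ-left-right i j₀))) (∑-if-−1 (leftPart A)))
    (trans (∑-cong (λ j → if-cong (rightPart A j) (Δ-right-right j j₀))) (∑-if-single (rightPart A) j₀ _)))
    (ℤP.+-comm (- + card (leftPart A)) _))

-- A counting criterion for parking configurations

¬T⇒T-not : ∀ {b} → ¬ T b → T (not b)
¬T⇒T-not {true}  ¬Tb = ¬Tb tt
¬T⇒T-not {false} ¬Tb = tt

T-not⇒¬T : ∀ {b} → T (not b) → ¬ T b
T-not⇒¬T {true} ()

#< : ∀ {p} → (Fin p → ℕ) → ℕ → ℕ
#< f t = card (λ i → f i <ᵇ t)

CutCondition : ∀ {n K} → (Fin n → ℕ) → (Fin K → ℕ) → Set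
CutCondition {K = K} a b = ∀ k → 1 ℕ.≤ k → k ℕ.≤ K → k ℕ.≤ #< b (#< a k)

-- With left values a and right values b (m = suc K), firing the left
-- vertices in P and the right vertices in Q leaves no vertex negative.
Fires : ∀ {n K} → (Fin n → ℕ) → (Fin K → ℕ) → (Fin n → Bool) → (Fin K → Bool) → Set
Fires {n} {K} a b P Q =
  (∀ i → T (P i) → suc K ℕ.≤ a i ℕ.+ card Q) × (∀ j → T (Q j) → n ℕ.≤ b j ℕ.+ card P)

disjoint⇒card+card≤ : ∀ {K} (P Q : Fin K → Bool) → (∀ i → T (P i) → T (not (Q i))) →
  card P ℕ.+ card Q ℕ.≤ K
disjoint⇒card+card≤ {K} P Q P∩Q≡∅ = begin
  card P ℕ.+ card Q                   ≤⟨ ℕP.+-monoˡ-≤ (card Q) (card-mono P (λ i → not (Q i)) P∩Q≡∅) ⟩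
  card (λ i → not (Q i)) ℕ.+ card Q   ≡⟨ ℕP.+-comm _ (card Q) ⟩
  card Q ℕ.+ card (λ i → not (Q i))   ≡⟨ card+card-not Q ⟩
  K                                   ∎
  where open ℕP.≤-Reasoning

-- If s = card Q > 0, no left vertex below k = m ∸ s can fire, hence no right
-- vertex below #< a k can fire either, and the cut condition at k is violated.
fires⇒¬0<card : ∀ {n K} (a : Fin n → ℕ) (b : Fin K → ℕ) → CutCondition a b →
  ∀ P Q → Fires a b P Q → ¬ (0 ℕ.< card Q)
fires⇒¬0<card {n} {K} a b cut P Q (fire-P , fire-Q) 0<s = ℕP.n≮n K (begin-strict
  K                  <⟨ ℕP.n<1+n K ⟩
  suc K              ≡⟨ k+s≡1+K ⟨
  k ℕ.+ s            ≤⟨ ℕP.+-monoˡ-≤ s (cut k 1≤k k≤K) ⟩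
  #< b L ℕ.+ s       ≤⟨ disjoint⇒card+card≤ (λ j → b j <ᵇ L) Q below-L⇒∉Q ⟩
  K                  ∎)
  where
  open ℕP.≤-Reasoning
  s k L : ℕ
  s = card Q
  k = suc K ∸ s
  L = #< a k
  k+s≡1+K : k ℕ.+ s ≡ suc K
  k+s≡1+K = ℕP.m∸n+n≡m (ℕP.m≤n⇒m≤1+n (card≤ Q))
  1≤k : 1 ℕ.≤ k
  1≤k = ℕP.m<n⇒0<n∸m (s≤s (card≤ Q))
  k≤K : k ℕ.≤ K
  k≤K = ℕP.∸-monoʳ-≤ (suc K) 0<s
  below-k⇒∉P : ∀ i → T (a i <ᵇ k) → T (not (P i))
  below-k⇒∉P i ai<k = ¬T⇒T-not λ i∈P → ℕP.<⇒≱
    (subst (a i ℕ.+ s ℕ.<_) k+s≡1+K (ℕP.+-monoˡ-< s (ℕP.<ᵇ⇒< (a i) k ai<k))) (fire-P i i∈P)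
  L+t≤n : L ℕ.+ card P ℕ.≤ n
  L+t≤n = disjoint⇒card+card≤ (λ i → a i <ᵇ k) P below-k⇒∉P
  below-L⇒∉Q : ∀ j → T (b j <ᵇ L) → T (not (Q j))
  below-L⇒∉Q j bj<L = ¬T⇒T-not λ j∈Q → ℕP.<⇒≱
    (ℕP.<-≤-trans (ℕP.+-monoˡ-< (card P) (ℕP.<ᵇ⇒< (b j) L bj<L)) L+t≤n) (fire-Q j j∈Q)

cut-condition⇒¬fires : ∀ {n K} (a : Fin n → ℕ) (b : Fin K → ℕ) → (∀ i → a i ℕ.≤ K) → CutCondition a b →
  ∀ P Q → Fires a b P Q → (Σ (Fin n) λ i → T (P i)) ⊎ (Σ (Fin K) λ j → T (Q j)) → ⊥
cut-condition⇒¬fires a b a≤K cut P Q fires (inj₂ (j , j∈Q)) =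
  fires⇒¬0<card a b cut P Q fires (∈⇒0<card Q j j∈Q)
cut-condition⇒¬fires {K = K} a b a≤K cut P Q fires@(fire-P , _) (inj₁ (i , i∈P)) = ℕP.<⇒≱
  (s≤s (subst (ℕ._≤ K) (sym (trans (cong (a i ℕ.+_) card-Q≡0) (ℕP.+-identityʳ (a i)))) (a≤K i)))
  (fire-P i i∈P)
  where
  card-Q≡0 : card Q ≡ 0
  card-Q≡0 = ℕP.n≤0⇒n≡0 (ℕP.≮⇒≥ (fires⇒¬0<card a b cut P Q fires))

violated-cut⇒fires : ∀ {n K} (a : Fin n → ℕ) (b : Fin K → ℕ) k → k ℕ.≤ K → #< b (#< a k) ℕ.< k →
  Σ (Fin n → Bool) λ P → Σ (Fin K → Bool) λ Q → Fires a b P Q × Σ (Fin K) λ j → T (Q j)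
violated-cut⇒fires {n} {K} a b k k≤K X<k = P , Q , (fire-P , fire-Q) , Q-nonempty
  where
  L X : ℕ
  L = #< a k
  X = #< b L
  P : Fin n → Bool
  P i = not (a i <ᵇ k)
  Q : Fin K → Bool
  Q j = not (b j <ᵇ L)
  ≮ᵇ⇒≥ : ∀ {x y} → T (not (x <ᵇ y)) → y ℕ.≤ x
  ≮ᵇ⇒≥ {x} {y} x≮y = ℕP.≮⇒≥ (λ x<y → T-not⇒¬T x≮y (ℕP.<⇒<ᵇ x<y))
  fire-P : ∀ i → T (P i) → suc K ℕ.≤ a i ℕ.+ card Q
  fire-P i i∈P = begin
    suc K              ≡⟨ cong suc (card+card-not (λ j → b j <ᵇ L)) ⟨
    suc X ℕ.+ card Q   ≤⟨ ℕP.+-monoˡ-≤ (card Q) (ℕP.≤-trans X<k (≮ᵇ⇒≥ i∈P)) ⟩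
    a i ℕ.+ card Q     ∎
    where open ℕP.≤-Reasoning
  fire-Q : ∀ j → T (Q j) → n ℕ.≤ b j ℕ.+ card P
  fire-Q j j∈Q = begin
    n                  ≡⟨ card+card-not (λ i → a i <ᵇ k) ⟨
    L ℕ.+ card P       ≤⟨ ℕP.+-monoˡ-≤ (card P) (≮ᵇ⇒≥ j∈Q) ⟩
    b j ℕ.+ card P     ∎
    where open ℕP.≤-Reasoning
  Q-nonempty : Σ (Fin K) λ j → T (Q j)
  Q-nonempty with card<⇒∃∉ (λ j → b j <ᵇ L) (ℕP.<-≤-trans X<k k≤K)
  ... | j , bj≮L = j , Equivalence.from T-not-≡ bj≮L

↑ˡ-or-↑ʳ : ∀ n K (x : Fin (n ℕ.+ K)) → (Σ (Fin n) λ i → i ↑ˡ K ≡ x) ⊎ (Σ (Fin K) λ j → n ↑ʳ j ≡ x)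
↑ˡ-or-↑ʳ n K x with splitAt n x in split≡
... | inj₁ i = inj₁ (i , FinP.splitAt⁻¹-↑ˡ split≡)
... | inj₂ j = inj₂ (j , FinP.splitAt⁻¹-↑ʳ split≡)

after-firing≡ : ∀ a y s → + a - (y - + s) ≡ + (a ℕ.+ s) - y
after-firing≡ a y s = trans (rearrange (+ a) y (+ s)) (cong (_- y) (sym (ℤP.pos-+ a s)))
  where
  rearrange : ∀ x y z → x - (y - z) ≡ (x + z) - y
  rearrange = solve-∀

vertex-nonneg⇔ : ∀ (p : Bool) (v a s : ℕ) →
  (0ℤ ≤ + a - ((if p then + v else 0ℤ) - + s)) ⇔ (T p → v ℕ.≤ a ℕ.+ s)
vertex-nonneg⇔ true v a s = mk⇔
  (λ 0≤ _ → ℤP.drop‿+≤+ (ℤP.0≤i-j⇒j≤i (subst (0ℤ ≤_) (after-firing≡ a (+ v) s) 0≤)))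
  (λ v≤a+s → subst (0ℤ ≤_) (sym (after-firing≡ a (+ v) s)) (ℤP.i≤j⇒0≤j-i (+≤+ (v≤a+s tt))))
vertex-nonneg⇔ false v a s = mk⇔ (λ _ ())
  (λ _ → subst (0ℤ ≤_) (sym (trans (after-firing≡ a 0ℤ s) (ℤP.+-identityʳ _))) (+≤+ z≤n))

Fires-cong : ∀ {n K} {a : Fin n → ℕ} {b : Fin K → ℕ} {P P' Q Q'} →
  (∀ i → P i ≡ P' i) → (∀ j → Q j ≡ Q' j) → Fires a b P Q → Fires a b P' Q'
Fires-cong {a = a} {b} P≗P' Q≗Q' (fire-P , fire-Q) =
    (λ i i∈P' → subst (λ s → _ ℕ.≤ a i ℕ.+ s) (card-cong Q≗Q') (fire-P i (subst T (sym (P≗P' i)) i∈P')))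
  , (λ j j∈Q' → subst (λ s → _ ℕ.≤ b j ℕ.+ s) (card-cong P≗P') (fire-Q j (subst T (sym (Q≗Q' j)) j∈Q')))

module _ (n K : ℕ) where

  -- Only meaningful for nonnegative c, see left≡leftℕ.
  leftℕ : Config n (suc K) → Fin n → ℕ
  leftℕ c i = ∣ c (i ↑ˡ K) ∣

  rightℕ : Config n (suc K) → Fin K → ℕ
  rightℕ c j = ∣ c (n ↑ʳ j) ∣

  module _ {c : Config n (suc K)} (c≥0 : NonNegative n (suc K) c) where

    left≡leftℕ : ∀ i → c (i ↑ˡ K) ≡ + leftℕ c i
    left≡leftℕ i = sym (ℤP.0≤i⇒+∣i∣≡i (c≥0 (i ↑ˡ K)))

    right≡rightℕ : ∀ j → c (n ↑ʳ j) ≡ + rightℕ c j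
    right≡rightℕ j = sym (ℤP.0≤i⇒+∣i∣≡i (c≥0 (n ↑ʳ j)))

    nonNegative-after-firing⇔ : ∀ A → NonNegative n (suc K) (λ x → c x - ΔSet n (suc K) A x)
      ⇔ Fires (leftℕ c) (rightℕ c) (leftPart n K A) (rightPart n K A)
    nonNegative-after-firing⇔ A = mk⇔
      (λ c-ΔA≥0 →
          (λ i → Equivalence.to (vertex-nonneg⇔ _ (suc K) (leftℕ c i) _)
                   (subst (0ℤ ≤_) (at-left i) (c-ΔA≥0 (i ↑ˡ K))))
        , (λ j → Equivalence.to (vertex-nonneg⇔ _ n (rightℕ c j) _)
                   (subst (0ℤ ≤_) (at-right j) (c-ΔA≥0 (n ↑ʳ j)))))
      (λ { (fire-P , fire-Q) x → case ↑ˡ-or-↑ʳ n K x of λ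
           { (inj₁ (i , refl)) → subst (0ℤ ≤_) (sym (at-left i))
                                   (Equivalence.from (vertex-nonneg⇔ _ (suc K) (leftℕ c i) _) (fire-P i))
           ; (inj₂ (j , refl)) → subst (0ℤ ≤_) (sym (at-right j))
                                   (Equivalence.from (vertex-nonneg⇔ _ n (rightℕ c j) _) (fire-Q j)) } })
      where
      at-left : ∀ i → c (i ↑ˡ K) - ΔSet n (suc K) A (i ↑ˡ K)
                      ≡ + leftℕ c i - ((if leftPart n K A i then + suc K else 0ℤ) - + card (rightPart n K A))
      at-left i = cong₂ _-_ (left≡leftℕ i) (ΔSet-left n K A i)
      at-right : ∀ j → c (n ↑ʳ j) - ΔSet n (suc K) A (n ↑ʳ j)
                       ≡ + rightℕ c j - ((if rightPart n K A j then + n else 0ℤ) - + card (leftPart n K A))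
      at-right j = cong₂ _-_ (right≡rightℕ j) (ΔSet-right n K A j)

  module _ {c : Config n (suc K)} (st : Stable n (suc K) c) where

    stable⇒leftℕ≤ : ∀ i → leftℕ c i ℕ.≤ K
    stable⇒leftℕ≤ i = ℤP.drop‿+≤+ (subst (_≤ + K) (left≡leftℕ (proj₁ st) i) (proj₁ (proj₂ st) i))

    stable⇒rightℕ≤ : ∀ j → rightℕ c j ℕ.≤ n ∸ 1
    stable⇒rightℕ≤ j = ℤP.drop‿+≤+ (subst (_≤ + (n ∸ 1)) (right≡rightℕ (proj₁ st) j) (proj₂ (proj₂ st) j))

  firingSet : (Fin n → Bool) → (Fin K → Bool) → Subset (n ℕ.+ K)
  firingSet P Q = Vec.tabulate P Vec.++ Vec.tabulate Q

  leftPart-firingSet : ∀ P Q i → leftPart n K (firingSet P Q) i ≡ P i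
  leftPart-firingSet P Q i =
    trans (VecP.lookup-++ˡ (Vec.tabulate P) (Vec.tabulate Q) i) (VecP.lookup∘tabulate P i)

  rightPart-firingSet : ∀ P Q j → rightPart n K (firingSet P Q) j ≡ Q j
  rightPart-firingSet P Q j =
    trans (VecP.lookup-++ʳ (Vec.tabulate P) (Vec.tabulate Q) j) (VecP.lookup∘tabulate Q j)

  parking⇒cut : ∀ {c} → Parking n (suc K) c → CutCondition (leftℕ c) (rightℕ c)
  parking⇒cut {c} ((c≥0 , _) , unfirable) k 1≤k k≤K with k ℕ.≤? #< (rightℕ c) (#< (leftℕ c) k)
  ... | yes k≤X = k≤X
  ... | no  k≰X with violated-cut⇒fires (leftℕ c) (rightℕ c) k k≤K (ℕP.≰⇒> k≰X)
  ...   | P , Q , fires , j , j∈Q = ⊥-elim (unfirable (firingSet P Q)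
            (n ↑ʳ j , VecP.lookup⇒[]= (n ↑ʳ j) _ (trans (rightPart-firingSet P Q j) (Equivalence.to T-≡ j∈Q)))
            (Equivalence.from (nonNegative-after-firing⇔ c≥0 (firingSet P Q))
              (Fires-cong (λ i → sym (leftPart-firingSet P Q i)) (λ j → sym (rightPart-firingSet P Q j)) fires)))

  stable×cut⇒parking : ∀ {c} → Stable n (suc K) c → CutCondition (leftℕ c) (rightℕ c) → Parking n (suc K) c
  stable×cut⇒parking {c} st cut = st , λ A (x , x∈A) c-ΔA≥0 →
    cut-condition⇒¬fires (leftℕ c) (rightℕ c) (stable⇒leftℕ≤ st) cut (leftPart n K A) (rightPart n K A)
      (Equivalence.to (nonNegative-after-firing⇔ (proj₁ st) A) c-ΔA≥0) (member A x (VecP.[]=⇒lookup x∈A))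
    where
    member : ∀ A x → Vec.lookup A x ≡ true →
      (Σ (Fin n) λ i → T (leftPart n K A i)) ⊎ (Σ (Fin K) λ j → T (rightPart n K A j))
    member A x x∈A with ↑ˡ-or-↑ʳ n K x
    ... | inj₁ (i , refl) = inj₁ (i , Equivalence.from T-≡ x∈A)
    ... | inj₂ (j , refl) = inj₂ (j , Equivalence.from T-≡ x∈A)

-- From lattice paths to parking configurations

+-cancelˡ-≤ : ∀ i {j k} → i + j ≤ i + k → j ≤ k
+-cancelˡ-≤ i {j} {k} i+j≤i+k = subst₂ _≤_ (cancel i j) (cancel i k) (ℤP.+-monoʳ-≤ (- i) i+j≤i+k)
  where
  cancel : ∀ i j → - i + (i + j) ≡ j
  cancel = solve-∀

+-cancelˡ-< : ∀ i {j k} → i + j < i + k → j < k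
+-cancelˡ-< i {j} {k} i+j<i+k = subst₂ _<_ (cancel i j) (cancel i k) (ℤP.+-monoʳ-< (- i) i+j<i+k)
  where
  cancel : ∀ i j → - i + (i + j) ≡ j
  cancel = solve-∀

p+[q-p]≡q : ∀ p q → p + (q - p) ≡ q
p+[q-p]≡q = solve-∀

module Relative (x₀ y₀ : ℤ) where

  StepFrom : Word → Step → ℤ → ℤ → Set
  StepFrom w a x y = StepAt w a (x₀ + x) (y₀ + y)

  north-east-separated-from : ∀ w {x y x' y'} → StepFrom w N x y → StepFrom w E x' y' →
    (y < y' × x ≤ x') ⊎ (x' < x × y' ≤ y)
  north-east-separated-from w north east with north-east-separated w north east
  ... | inj₁ (y<y' , x≤x') = inj₁ (+-cancelˡ-< y₀ y<y' , +-cancelˡ-≤ x₀ x≤x')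
  ... | inj₂ (x'<x , y'≤y) = inj₂ (+-cancelˡ-< x₀ x'<x , +-cancelˡ-≤ y₀ y'≤y)

x+y+1≡y+[1+x] : ∀ x y → x + y + 1ℤ ≡ y + (1ℤ + x)
x+y+1≡y+[1+x] = solve-∀

<1+⇒≤ : ∀ {x y} → x < 1ℤ + y → x ≤ y
<1+⇒≤ x<1+y = +-cancelˡ-≤ 1ℤ (ℤP.i<j⇒suc[i]≤j x<1+y)

module FromPaths (n' K : ℕ) (c : Config (suc n') (suc K)) (u ℓ : Word) (y₁ y₂ : ℤ)
  (u∈B : B K n' u) (ℓ∈B : B K (suc n') ℓ) (y-stable : StableIntersection u ℓ y₁ y₂)
  (c≡M : IsM (suc n') (suc K) u ℓ y₁ y₂ c) where

  open Relative y₁ y₂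

  n : ℕ
  n = suc n'
  G R : Word
  G = Gw ℓ
  R = Rw u

  east-G₀ : StepFrom G E 0ℤ 0ℤ
  east-G₀ = subst₂ (StepAt G E) (sym (ℤP.+-identityʳ y₁)) (sym (ℤP.+-identityʳ y₂))
    (startsStep⇒stepAt (proj₂ y-stable))

  east-G₁ : StepFrom G E (+ suc K) (+ n)
  east-G₁ = subst₂ (λ p q → StepAt G E (y₁ + + p) (y₂ + + q))
    (trans (sym (countE≡count G)) (cong suc (proj₁ ℓ∈B)))
    (trans (sym (countN≡count G)) (proj₂ ℓ∈B))
    (stepAt-+period (startsStep⇒stepAt (proj₂ y-stable)))

  north-R₀ : StepFrom R N 0ℤ 0ℤ
  north-R₀ = subst₂ (StepAt R N) (sym (ℤP.+-identityʳ y₁)) (sym (ℤP.+-identityʳ y₂))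
    (startsStep⇒stepAt (proj₁ y-stable))

  north-R₁ : StepFrom R N (+ K) (+ n)
  north-R₁ = subst₂ (λ p q → StepAt R N (y₁ + + p) (y₂ + + q))
    (trans (sym (countE≡count R)) (proj₁ u∈B))
    (trans (sym (countN≡count R)) (cong suc (proj₂ u∈B)))
    (stepAt-+period (startsStep⇒stepAt (proj₁ y-stable)))

  north-G : ∀ i → StepFrom G N (1ℤ + c (i ↑ˡ K)) (+ toℕ i)
  north-G i = subst (λ x → StepAt G N x (y₂ + + toℕ i)) (x+y+1≡y+[1+x] (c (i ↑ˡ K)) y₁)
    (startsStep⇒stepAt (proj₁ c≡M i))

  east-R : ∀ j → StepFrom R E (+ toℕ j) (1ℤ + c (n ↑ʳ j))
  east-R j = subst (StepAt R E (y₁ + + toℕ j)) (x+y+1≡y+[1+x] (c (n ↑ʳ j)) y₂)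
    (startsStep⇒stepAt (proj₂ c≡M j))

  stable : Stable n (suc K) c
  stable = c≥0 , left≤K , right≤n'
    where
    c≥0 : NonNegative n (suc K) c
    c≥0 x with ↑ˡ-or-↑ʳ n K x
    ... | inj₁ (i , refl) with north-east-separated-from G (north-G i) east-G₀
    ...   | inj₁ (+<+ () , _)
    ...   | inj₂ (0<1+ci , _) = <1+⇒≤ 0<1+ci
    c≥0 x | inj₂ (j , refl) with north-east-separated-from R north-R₀ (east-R j)
    ...   | inj₁ (0<1+cj , _) = <1+⇒≤ 0<1+cj
    ...   | inj₂ (+<+ () , _)
    left≤K : ∀ i → c (i ↑ˡ K) ≤ + K
    left≤K i with north-east-separated-from G (north-G i) east-G₁
    ... | inj₁ (_ , 1+ci≤1+K) = +-cancelˡ-≤ 1ℤ 1+ci≤1+K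
    ... | inj₂ (_ , n≤i)      = ⊥-elim (ℕP.<⇒≱ (FinP.toℕ<n i) (ℤP.drop‿+≤+ n≤i))
    right≤n' : ∀ j → c (n ↑ʳ j) ≤ + n'
    right≤n' j with north-east-separated-from R north-R₁ (east-R j)
    ... | inj₁ (_ , K≤j)       = ⊥-elim (ℕP.<⇒≱ (FinP.toℕ<n j) (ℤP.drop‿+≤+ K≤j))
    ... | inj₂ (_ , 1+cj≤1+n') = +-cancelˡ-≤ 1ℤ 1+cj≤1+n'

  a : Fin n → ℕ
  a = leftℕ n K c
  b : Fin K → ℕ
  b = rightℕ n K c

  north-Gℕ : ∀ i → StepFrom G N (+ suc (a i)) (+ toℕ i)
  north-Gℕ i = subst (λ x → StepFrom G N (1ℤ + x) (+ toℕ i)) (left≡leftℕ n K (proj₁ stable) i) (north-G i)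

  east-Rℕ : ∀ j → StepFrom R E (+ toℕ j) (+ suc (b j))
  east-Rℕ j = subst (λ y → StepFrom R E (+ toℕ j) (1ℤ + y)) (right≡rightℕ n K (proj₁ stable) j) (east-R j)

  cut-at : ∀ k {h x} → k ℕ.≤ K → StepFrom G E (+ k) h → StepFrom R N x h → + k ≤ x →
    k ℕ.≤ #< b (#< a k)
  cut-at k {h} {x} k≤K east north k≤x = initial⊆⇒≤card (λ j → b j <ᵇ #< a k) k k≤K (λ j j<k →
    ℕP.<⇒<ᵇ (below j j<k))
    where
    below : ∀ j → toℕ j ℕ.< k → b j ℕ.< #< a k
    below j j<k with north-east-separated-from R north (east-Rℕ j)
    ... | inj₁ (_ , x≤j) = ⊥-elim (ℕP.<⇒≱ j<k (ℤP.drop‿+≤+ (ℤP.≤-trans k≤x x≤j)))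
    ... | inj₂ (_ , 1+bj≤h) = initial⊆⇒≤card (λ i → a i <ᵇ k) (suc (b j))
            (s≤s (stable⇒rightℕ≤ n K stable j)) (λ i i≤bj → ℕP.<⇒<ᵇ (left-below i i≤bj))
      where
      left-below : ∀ i → toℕ i ℕ.< suc (b j) → a i ℕ.< k
      left-below i i≤bj with north-east-separated-from G (north-Gℕ i) east
      ... | inj₁ (_ , 1+ai≤k) = ℤP.drop‿+≤+ 1+ai≤k
      ... | inj₂ (_ , h≤i)    = ⊥-elim (ℕP.<⇒≱ i≤bj (ℤP.drop‿+≤+ (ℤP.≤-trans 1+bj≤h h≤i)))

  cut-condition : (∀ (j : Fin K) → ∃[ v ] (Pos-is u ℓ (y₁ + + (1 ℕ.+ toℕ j)) v × v ≤ 0ℤ)) → CutCondition a b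
  cut-condition pos (suc k) (s≤s z≤n) 1+k≤K with pos (Fin.fromℕ< 1+k≤K)
  ... | v , (h , x , east , north , v≡) , v≤0 = cut-at (suc k) 1+k≤K
    (subst₂ (λ p q → StepAt G E (y₁ + + p) q) 1+j≡1+k (sym (p+[q-p]≡q y₂ h)) (startsStep⇒stepAt east))
    (subst₂ (StepAt R N) (sym (p+[q-p]≡q y₁ x)) (sym (p+[q-p]≡q y₂ h)) (startsStep⇒stepAt north))
    (+-cancelˡ-≤ y₁ (subst₂ (λ p q → y₁ + + p ≤ q) 1+j≡1+k (sym (p+[q-p]≡q y₁ x))
      (ℤP.i-j≤0⇒i≤j (subst (_≤ 0ℤ) v≡ v≤0))))
    where
    1+j≡1+k : 1 ℕ.+ toℕ (Fin.fromℕ< 1+k≤K) ≡ suc k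
    1+j≡1+k = cong suc (FinP.toℕ-fromℕ< 1+k≤K)

-- Lattice paths from sorted configurations

Monotone : ∀ {p} → (Fin p → ℕ) → Set
Monotone f = ∀ s t → toℕ s ℕ.≤ toℕ t → f s ℕ.≤ f t

-- staircase p f e = a^(f₀ ∸ e) ā a^(f₁ ∸ f₀) ā … ā a^(M ∸ f_(p-1)), ā = other a
module Staircase (a : Step) (M : ℕ) where

  staircase : (p : ℕ) → (Fin p → ℕ) → ℕ → Word
  staircase zero    f e = replicate (M ∸ e) a
  staircase (suc p) f e = replicate (f Fin.zero ∸ e) a ++ other a ∷ staircase p (λ s → f (Fin.suc s)) (f Fin.zero)

  private
    ∸-+-∸ : ∀ {e f g} → e ℕ.≤ f → f ℕ.≤ g → (f ∸ e) ℕ.+ (g ∸ f) ≡ g ∸ e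
    ∸-+-∸ {e} {f} {g} e≤f f≤g = trans (sym (ℕP.m+n∸m≡n e _)) (cong (_∸ e) (trans (sym (ℕP.+-assoc e _ _))
      (trans (cong (ℕ._+ (g ∸ f)) (ℕP.m+[n∸m]≡n e≤f)) (ℕP.m+[n∸m]≡n f≤g))))

    count-block : ∀ k w → count a (replicate k a ++ other a ∷ w) ≡ k ℕ.+ count a w
    count-block k w = begin
      count a (replicate k a ++ other a ∷ w)                     ≡⟨ count-++ a (replicate k a) _ ⟩
      count a (replicate k a) ℕ.+ (match a (other a) ℕ.+ count a w) ≡⟨ cong₂ ℕ._+_ (count-replicate-self a k)
                                                                       (cong (ℕ._+ count a w) (match-other a)) ⟩
      k ℕ.+ count a w                                           ∎
      where open ≡-Reasoning

    count-other-block : ∀ k w → count (other a) (replicate k a ++ other a ∷ w) ≡ suc (count (other a) w)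
    count-other-block k w = begin
      count (other a) (replicate k a ++ other a ∷ w)
        ≡⟨ count-++ (other a) (replicate k a) _ ⟩
      count (other a) (replicate k a) ℕ.+ (match (other a) (other a) ℕ.+ count (other a) w)
        ≡⟨ cong₂ ℕ._+_ (count-other-replicate a k) (cong (ℕ._+ count (other a) w) (match-self (other a))) ⟩
      suc (count (other a) w) ∎
      where open ≡-Reasoning

  count-other-staircase : ∀ p f e → count (other a) (staircase p f e) ≡ p
  count-other-staircase zero    f e = count-other-replicate a (M ∸ e)
  count-other-staircase (suc p) f e =
    trans (count-other-block (f Fin.zero ∸ e) _) (cong suc (count-other-staircase p _ _))

  count-staircase : ∀ p f e → Monotone f → (∀ s → f s ℕ.≤ M) → (∀ s → e ℕ.≤ f s) → e ℕ.≤ M →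
    count a (staircase p f e) ≡ M ∸ e
  count-staircase zero    f e _ _ _ _ = count-replicate-self a (M ∸ e)
  count-staircase (suc p) f e mono f≤M e≤f e≤M =
    trans (count-block (f Fin.zero ∸ e) _)
      (trans (cong (f Fin.zero ∸ e ℕ.+_)
               (count-staircase p _ _ (λ s t → mono (Fin.suc s) (Fin.suc t) ∘ s≤s) (λ s → f≤M (Fin.suc s))
                  (λ s → mono Fin.zero (Fin.suc s) z≤n) (f≤M Fin.zero)))
        (∸-+-∸ (e≤f Fin.zero) (f≤M Fin.zero)))

  separator : ∀ p f e → Monotone f → (∀ s → e ℕ.≤ f s) → ∀ (s : Fin p) →
    Σ Word λ pre → Σ Word λ suf → staircase p f e ≡ pre ++ other a ∷ suf
      × count a pre ≡ f s ∸ e × count (other a) pre ≡ toℕ s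
  separator (suc p) f e mono e≤f Fin.zero =
    replicate (f Fin.zero ∸ e) a , staircase p _ _ , refl ,
    count-replicate-self a _ , count-other-replicate a (f Fin.zero ∸ e)
  separator (suc p) f e mono e≤f (Fin.suc s)
    with separator p (λ s → f (Fin.suc s)) (f Fin.zero) (λ s t → mono (Fin.suc s) (Fin.suc t) ∘ s≤s)
           (λ s → mono Fin.zero (Fin.suc s) z≤n) s
  ... | pre , suf , ≡pre++ , count-pre , count-other-pre =
    replicate (f Fin.zero ∸ e) a ++ other a ∷ pre , suf ,
    trans (cong (λ w → replicate (f Fin.zero ∸ e) a ++ other a ∷ w) ≡pre++)
          (sym (ListP.++-assoc (replicate (f Fin.zero ∸ e) a) (other a ∷ pre) (other a ∷ suf))) ,
    trans (count-block _ pre) (trans (cong (f Fin.zero ∸ e ℕ.+_) count-pre)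
                                     (∸-+-∸ (e≤f Fin.zero) (mono Fin.zero (Fin.suc s) z≤n))) ,
    trans (count-other-block (f Fin.zero ∸ e) pre) (cong suc count-other-pre)

position-after : ∀ pre (b : Step) suf → Σ (Fin (length (pre ++ b ∷ suf))) λ r →
  lookup (pre ++ b ∷ suf) r ≡ b × take (toℕ r) (pre ++ b ∷ suf) ≡ pre
position-after []        b suf = Fin.zero , refl , refl
position-after (x ∷ pre) b suf with position-after pre b suf
... | r , w[r]≡b , take≡pre = Fin.suc r , w[r]≡b , cong (x ∷_) take≡pre

step-after-prefix : ∀ pre b suf → StepAt (pre ++ b ∷ suf) b (+ count E pre) (+ count N pre)
step-after-prefix pre b suf with position-after pre b suf
... | r , w[r]≡b , take≡pre = 0ℤ , r , w[r]≡b , at-first-copy E , at-first-copy N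
  where
  w : Word
  w = pre ++ b ∷ suf
  at-first-copy : ∀ a → + count a pre ≡ coord a w 0ℤ r
  at-first-copy a = sym (trans (cong₂ _+_ (ℤP.*-zeroʳ (+ count a w)) (cong (λ v → + count a v) take≡pre))
                               (ℤP.+-identityˡ _))

module ToPaths (n' K : ℕ) (c : Config (suc n') (suc K)) (st : Stable (suc n') (suc K) c)
  (sorted : Sorted (suc n') (suc K) c) (cut : CutCondition (leftℕ (suc n') K c) (rightℕ (suc n') K c)) where

  n : ℕ
  n = suc n'
  a : Fin n → ℕ
  a = leftℕ n K c
  b : Fin K → ℕ
  b = rightℕ n K c

  a-mono : Monotone a
  a-mono s t s≤t = ℤP.drop‿+≤+ (subst₂ _≤_ (left≡leftℕ n K (proj₁ st) s) (left≡leftℕ n K (proj₁ st) t)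
                                         (proj₁ sorted s t s≤t))

  b-mono : Monotone b
  b-mono s t s≤t = ℤP.drop‿+≤+ (subst₂ _≤_ (right≡rightℕ n K (proj₁ st) s) (right≡rightℕ n K (proj₁ st) t)
                                         (proj₂ sorted s t s≤t))

  module SE = Staircase E K
  module SN = Staircase N n'

  ℓ' u' G R : Word
  ℓ' = SE.staircase n a 0
  u' = SN.staircase K b 0
  G = Gw ℓ'
  R = Rw u'

  ℓ'∈B : B K n ℓ'
  ℓ'∈B = trans (countE≡count ℓ') (SE.count-staircase n a 0 a-mono (stable⇒leftℕ≤ n K st) (λ _ → z≤n) z≤n)
       , trans (countN≡count ℓ') (SE.count-other-staircase n a 0)

  u'∈B : B K n' u'
  u'∈B = trans (countE≡count u') (SN.count-other-staircase K b 0)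
       , trans (countN≡count u') (SN.count-staircase K b 0 b-mono (stable⇒rightℕ≤ n K st) (λ _ → z≤n) z≤n)

  origin-stable : StableIntersection u' ℓ' 0ℤ 0ℤ
  origin-stable = stepAt⇒startsStep (step-after-prefix [] N u') , stepAt⇒startsStep (step-after-prefix [] E ℓ')

  north-G : ∀ i → StepAt G N (+ suc (a i)) (+ toℕ i)
  north-G i with SE.separator n a 0 a-mono (λ _ → z≤n) i
  ... | pre , suf , ℓ'≡ , count-E , count-N =
    subst₂ (StepAt G N) (cong (λ s → + suc s) count-E) (cong +_ count-N)
      (subst (λ w → StepAt w N (+ suc (count E pre)) (+ count N pre)) (sym (cong (E ∷_) ℓ'≡))
         (step-after-prefix (E ∷ pre) N suf))

  east-R : ∀ j → StepAt R E (+ toℕ j) (+ suc (b j))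
  east-R j with SN.separator K b 0 b-mono (λ _ → z≤n) j
  ... | pre , suf , u'≡ , count-N , count-E =
    subst₂ (StepAt R E) (cong +_ count-E) (cong (λ s → + suc s) count-N)
      (subst (λ w → StepAt w E (+ count E pre) (+ suc (count N pre))) (sym (cong (N ∷_) u'≡))
         (step-after-prefix (N ∷ pre) E suf))

  c≡M : IsM n (suc K) u' ℓ' 0ℤ 0ℤ c
  c≡M = (λ i → stepAt⇒startsStep (subst (λ x → StepAt G N x (+ toℕ i))
                                       (at-origin (left≡leftℕ n K (proj₁ st) i)) (north-G i)))
      , (λ j → stepAt⇒startsStep (subst (StepAt R E (+ toℕ j))
                                       (at-origin (right≡rightℕ n K (proj₁ st) j)) (east-R j)))
    where
    at-origin : ∀ {z v} → z ≡ + v → + suc v ≡ z + 0ℤ + 1ℤ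
    at-origin {z} refl = sym (x+y+1≡y+[1+x] z 0ℤ)

  east-left-of-north : ∀ (j : Fin K) → ∃[ v ] (Pos-is u' ℓ' (0ℤ + + (1 ℕ.+ toℕ j)) v × v ≤ 0ℤ)
  east-left-of-north j with east-step-at G (+ suc (toℕ j))
  ... | h , east with north-step-at R h
  ... | x , north = + k - x , (h , x , stepAt⇒startsStep east , stepAt⇒startsStep north , refl) , ℤP.i≤j⇒i-j≤0 k≤x
    where
    k L : ℕ
    k = suc (toℕ j)
    L = #< a k
    left-below : ∀ i → T (a i <ᵇ k) → + toℕ i < h
    left-below i ai<k with north-east-separated G (north-G i) east
    ... | inj₁ (i<h , _)   = i<h
    ... | inj₂ (k<1+ai , _) = ⊥-elim (ℕP.<⇒≱ (ℕP.<ᵇ⇒< (a i) k ai<k) (ℕP.≤-pred (ℤP.drop‿+<+ k<1+ai)))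
    right-left-of : ∀ j' → T (b j' <ᵇ L) → + toℕ j' < x
    right-left-of j' bj'<L with north-east-separated R north (east-R j')
    ... | inj₂ (j'<x , _)   = j'<x
    ... | inj₁ (h<1+bj' , _) = ⊥-elim (ℕP.<⇒≱ (ℕP.<ᵇ⇒< (b j') L bj'<L)
            (⊆initial⇒card≤ (λ i → a i <ᵇ k) (b j') λ i ai<k →
              ℤP.drop‿+<+ (ℤP.<-≤-trans (left-below i ai<k) (<1+⇒≤ h<1+bj'))))
    -- If x < k, then fewer than k right values would lie below L.
    k≤x : + k ≤ x
    k≤x with + k ℤP.≤? x
    ... | yes k≤x = k≤x
    ... | no  k≰x = ⊥-elim (ℕP.<⇒≱ (s≤s (⊆initial⇒card≤ (λ j' → b j' <ᵇ L) (toℕ j) before-j))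
                                   (cut k (s≤s z≤n) (FinP.toℕ<n j)))
      where
      before-j : ∀ j' → T (b j' <ᵇ L) → toℕ j' ℕ.< toℕ j
      before-j j' bj'<L = ℕP.≤-pred (ℤP.drop‿+<+
        (ℤP.≤-<-trans (ℤP.i<j⇒suc[i]≤j (right-left-of j' bj'<L)) (ℤP.≰⇒> k≰x)))

corollary5p15 : (m n : ℕ) → 1 Data.Nat.≤ m → 1 Data.Nat.≤ n →
    (c : Config n m) → Sorted n m c →
    Parking n m c ⇔
      (∃[ u'' ] ∃[ ℓ' ] ∃[ y₁ ] ∃[ y₂ ]
         (B (m ∸ 1) (n ∸ 1) u'' × B (m ∸ 1) n ℓ'
          × StableIntersection u'' ℓ' y₁ y₂
          × IsM n m u'' ℓ' y₁ y₂ c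
          × (∀ (j : Fin (m ∸ 1)) →
               ∃[ v ] (Pos-is u'' ℓ' (y₁ + + (1 Data.Nat.+ toℕ j)) v × v ≤ 0ℤ))))
corollary5p15 (suc K) (suc n') (s≤s z≤n) (s≤s z≤n) c sorted = mk⇔
  (λ parking →
    let open ToPaths n' K c (proj₁ parking) sorted (parking⇒cut (suc n') K parking)
    in u' , ℓ' , 0ℤ , 0ℤ , u'∈B , ℓ'∈B , origin-stable , c≡M , east-left-of-north)
  (λ { (u , ℓ , y₁ , y₂ , u∈B , ℓ∈B , y-stable , c≡M , pos) →
    let open FromPaths n' K c u ℓ y₁ y₂ u∈B ℓ∈B y-stable c≡M
    in stable×cut⇒parking (suc n') K stable (cut-condition pos) })
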